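{- Let $n=6t+5+r$ with $t\ge 1$ and $0\le r<6$, and let $u_n$ be the word consisting of the first $n$ letters of the word $w_{t+1}=aabab(bbaaba)^{t+1}$. Then $m(u_n)=2t+m_r$, where $m_0=2$, $m_1=3$, $m_2=3$, $m_3=3$, $m_4=4$, $m_5=4$.
   Context: Words are finite strings over the alphabet $\{a,b\}$; $u^k$ is the $k$-fold concatenation of $u$. A word $a_0\dots a_n$ is a palindrome if $a_i=a_{n-i}$ for all $i\le n$. For a nonempty word $w$, $m(w)$ is the minimal number of nonempty palindromes whose concatenation equals $w$. -}

module Defs where

open import Data.Nat using (ℕ; zero; suc; _+_; _*_)
open import Data.List using (List; []; _∷_; _++_; length; take; concat; replicate)
open import Data.List.Relation.Unary.All using (All)
open import Data.Fin using (Fin; opposite)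
open import Data.List using (lookup)
open import Relation.Binary.PropositionalEquality using (_≡_; _≢_)

data Letter : Set where
  a b : Letter

Word : Set
Word = List Letter

_^ʷ_ : Word → ℕ → Word
u ^ʷ k = concat (replicate k u)

IsPalindrome : Word → Set
IsPalindrome w = (i : Fin (length w)) → lookup w i ≡ lookup w (opposite i)

NonEmpty : Word → Set
NonEmpty w = w ≢ []

IsNonemptyPalindrome : Word → Set
IsNonemptyPalindrome w = NonEmpty w × IsPalindrome w
  where open import Data.Product using (_×_)

PalFactorization : Word → List Word → Set
PalFactorization w ps = All IsNonemptyPalindrome ps × concat ps ≡ w
  where open import Data.Product using (_×_)

PalLength : Word → ℕ → Set
PalLength w k =
  (Σ (List Word) λ ps → PalFactorization w ps × length ps ≡ k)
  × ((ps : List Word) → PalFactorization w ps → k ≤ length ps)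
  where open import Data.Product using (_×_; Σ)
        open import Data.Nat using (_≤_)

wWord : ℕ → Word
wWord t = (a ∷ a ∷ b ∷ a ∷ b ∷ []) ++ ((b ∷ b ∷ a ∷ a ∷ b ∷ a ∷ []) ^ʷ t)

mTable : Fin 6 → ℕ
mTable Fin.zero = 2
mTable (Fin.suc Fin.zero) = 3
mTable (Fin.suc (Fin.suc Fin.zero)) = 3
mTable (Fin.suc (Fin.suc (Fin.suc Fin.zero))) = 3
mTable (Fin.suc (Fin.suc (Fin.suc (Fin.suc Fin.zero)))) = 4
mTable (Fin.suc (Fin.suc (Fin.suc (Fin.suc (Fin.suc Fin.zero))))) = 4

module Submission where

-- All words u_n are prefixes of the infinite word ω = aabab (bbaaba)(bbaaba)…,
-- so we work with ω as a function ℕ → Letter and with its factors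
-- factor i ℓ = ω(i) … ω(i+ℓ-1).  The claimed value of m(prefix of length n) is
-- μ n = 1 + ⌊n/3⌋ for n ≥ 1 (and μ 0 = 0); the theorem is the instance
-- n = 6t+5+r of the statement "m(factor 0 n) = μ n".
--
-- A finite check on one period (positions 0…10, then ω and μ
-- are 6-periodic up to a shift of μ by 2) shows that ω has no palindromic
-- factor of length 6 or 7, hence none of length ≥ 6 (strip the outer letters),
-- and that appending a palindromic factor of length < 6 raises μ by at most 1.
-- Hence any factorization of factor 0 n into k palindromes has μ n ≤ k.
--
-- For every n ≥ 1 there is a palindromic factor ending at
-- position n, starting at some i with μ i + 1 = μ n (explicit table for
-- n ≤ 16, then periodicity); strong induction assembles a factorization
-- of length μ n.

open import Defs
open import Data.Nat using (ℕ; suc; _+_; _*_; _≤_)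
open import Data.Fin using (Fin; toℕ)
open import Data.List using (take)

open import Data.Nat using (zero; _∸_; _<_; s≤s; _≟_; _≤?_; _<?_)
open import Data.Nat.Properties
open import Data.Nat.Induction using (<-rec)
open import Data.Fin using (inject₁; opposite; fromℕ<)
open import Data.Fin.Properties using (all?; toℕ<n; toℕ-inject₁; toℕ-fromℕ<; opposite-prop)
open import Data.List using (List; []; _∷_; _++_; length; concat; lookup)
open import Data.List.Properties using (++-identityʳ; concat-++; length-++; ∷-injective)
open import Data.List.Relation.Unary.All using (All; []; _∷_)
open import Data.List.Relation.Unary.All.Properties using (++⁺)
open import Data.Product using (Σ; _×_; _,_; proj₁; proj₂)
open import Data.Empty using (⊥-elim)
open import Data.Unit using (tt)
open import Relation.Nullary using (Dec; yes; no; ¬_)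
open import Relation.Nullary.Decidable using (True; toWitness; ¬?; _×-dec_; _→-dec_)
open import Relation.Binary.PropositionalEquality

ω : ℕ → Letter
ω 0 = a
ω 1 = a
ω 2 = b
ω 3 = a
ω 4 = b
ω 5 = b
ω 6 = b
ω 7 = a
ω 8 = a
ω 9 = b
ω 10 = a
ω (suc (suc (suc (suc (suc (suc (suc (suc (suc (suc (suc k))))))))))) =
  ω (suc (suc (suc (suc (suc k)))))

factor : ℕ → ℕ → Word
factor i zero = []
factor i (suc ℓ) = ω i ∷ factor (suc i) ℓ

factor-periodic : ∀ x ℓ → factor (11 + x) ℓ ≡ factor (5 + x) ℓ
factor-periodic x zero = refl
factor-periodic x (suc ℓ) = cong (ω (5 + x) ∷_) (factor-periodic (suc x) ℓ)

factor-++ : ∀ i ℓ m → factor i (ℓ + m) ≡ factor i ℓ ++ factor (i + ℓ) m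
factor-++ i zero m = cong (λ j → factor j m) (sym (+-identityʳ i))
factor-++ i (suc ℓ) m =
  cong (ω i ∷_) (trans (factor-++ (suc i) ℓ m) (cong (λ j → factor (suc i) ℓ ++ factor j m) (sym (+-suc i ℓ))))

take-factor : ∀ i j n → j ≤ n → take j (factor i n) ≡ factor i j
take-factor i zero n _ = refl
take-factor i (suc j) (suc n) (s≤s j≤n) = cong (ω i ∷_) (take-factor (suc i) j n j≤n)

factor-split : ∀ xs ys i n → xs ++ ys ≡ factor i n →
  Σ ℕ λ m → n ≡ length xs + m × xs ≡ factor i (length xs) × ys ≡ factor (i + length xs) m
factor-split [] ys i n eq = n , refl , refl , trans eq (cong (λ j → factor j n) (sym (+-identityʳ i)))
factor-split (x ∷ xs) ys i zero ()
factor-split (x ∷ xs) ys i (suc n) eq with ∷-injective eq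
... | x≡ωi , rest with factor-split xs ys (suc i) n rest
...   | m , n≡ , xs≡ , ys≡ =
  m , cong suc n≡ , cong₂ _∷_ x≡ωi xs≡ , trans ys≡ (cong (λ j → factor j m) (sym (+-suc i (length xs))))

factor-nonempty : ∀ i {ℓ} → 1 ≤ ℓ → NonEmpty (factor i ℓ)
factor-nonempty i (s≤s _) ()

lookup-factor : ∀ (p : Word) i n → p ≡ factor i n → (k : Fin (length p)) → lookup p k ≡ ω (i + toℕ k)
lookup-factor (x ∷ p) i (suc n) eq Fin.zero = trans (proj₁ (∷-injective eq)) (cong ω (sym (+-identityʳ i)))
lookup-factor (x ∷ p) i (suc n) eq (Fin.suc k) =
  trans (lookup-factor p (suc i) n (proj₂ (∷-injective eq)) k) (cong ω (sym (+-suc i (toℕ k))))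

_≟ˡ_ : (x y : Letter) → Dec (x ≡ y)
a ≟ˡ a = yes refl
b ≟ˡ b = yes refl
a ≟ˡ b = no (λ ())
b ≟ˡ a = no (λ ())

PalAt : ℕ → ℕ → Set
PalAt i ℓ = (k : Fin ℓ) → ω (i + toℕ k) ≡ ω (i + (ℓ ∸ suc (toℕ k)))

palAt? : ∀ i ℓ → Dec (PalAt i ℓ)
palAt? i ℓ = all? (λ k → ω (i + toℕ k) ≟ˡ ω (i + (ℓ ∸ suc (toℕ k))))

palindrome⇒PalAt : ∀ p i → p ≡ factor i (length p) → IsPalindrome p → PalAt i (length p)
palindrome⇒PalAt p i eq pal k = begin
  ω (i + toℕ k)                       ≡⟨ sym (lookup-factor p i _ eq k) ⟩
  lookup p k                          ≡⟨ pal k ⟩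
  lookup p (opposite k)               ≡⟨ lookup-factor p i _ eq (opposite k) ⟩
  ω (i + toℕ (opposite k))            ≡⟨ cong (λ j → ω (i + j)) (opposite-prop k) ⟩
  ω (i + (length p ∸ suc (toℕ k)))    ∎
  where open ≡-Reasoning

PalAt-inner : ∀ i ℓ → PalAt i (suc (suc ℓ)) → PalAt (suc i) ℓ
PalAt-inner i ℓ pal k = begin
  ω (suc i + toℕ k)                  ≡⟨ cong ω (sym (+-suc i (toℕ k))) ⟩
  ω (i + suc (toℕ k))                ≡⟨ cong (λ j → ω (i + suc j)) (sym (toℕ-inject₁ k)) ⟩
  ω (i + suc (toℕ (inject₁ k)))      ≡⟨ pal (Fin.suc (inject₁ k)) ⟩
  ω (i + (ℓ ∸ toℕ (inject₁ k)))      ≡⟨ cong (λ j → ω (i + (ℓ ∸ j))) (toℕ-inject₁ k) ⟩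
  ω (i + (ℓ ∸ toℕ k))                ≡⟨ cong (λ j → ω (i + j)) (+-∸-assoc 1 (toℕ<n k)) ⟩
  ω (i + suc (ℓ ∸ suc (toℕ k)))      ≡⟨ cong ω (+-suc i _) ⟩
  ω (suc i + (ℓ ∸ suc (toℕ k)))      ∎
  where open ≡-Reasoning

⌊_/3⌋ : ℕ → ℕ
⌊ 0 /3⌋ = 0
⌊ 1 /3⌋ = 0
⌊ 2 /3⌋ = 0
⌊ suc (suc (suc k)) /3⌋ = suc ⌊ k /3⌋

μ : ℕ → ℕ
μ zero = 0
μ (suc n) = suc ⌊ suc n /3⌋

LocalFacts : ℕ → Set
LocalFacts i = ¬ PalAt i 6 × ¬ PalAt i 7
  × ((ℓ : Fin 6) → PalAt i (toℕ ℓ) → μ (i + toℕ ℓ) ≤ suc (μ i))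

localFacts? : ∀ i → Dec (LocalFacts i)
localFacts? i = ¬? (palAt? i 6) ×-dec ¬? (palAt? i 7)
  ×-dec all? (λ ℓ → palAt? i (toℕ ℓ) →-dec (μ (i + toℕ ℓ) ≤? suc (μ i)))

checkLocal : ∀ i → {{True (localFacts? i)}} → LocalFacts i
checkLocal i {{ok}} = toWitness ok

-- Checked on positions 0…10; beyond, ω is 6-periodic and μ shifts by 2.
localFacts : ∀ i → LocalFacts i
localFacts 0 = checkLocal 0
localFacts 1 = checkLocal 1
localFacts 2 = checkLocal 2
localFacts 3 = checkLocal 3
localFacts 4 = checkLocal 4
localFacts 5 = checkLocal 5
localFacts 6 = checkLocal 6
localFacts 7 = checkLocal 7
localFacts 8 = checkLocal 8
localFacts 9 = checkLocal 9
localFacts 10 = checkLocal 10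
localFacts (suc (suc (suc (suc (suc (suc (suc (suc (suc (suc (suc x))))))))))) with localFacts (5 + x)
... | no6 , no7 , short = no6 , no7 , λ ℓ pal → s≤s (s≤s (short ℓ pal))

no-long-palindrome : ∀ m i → ¬ PalAt i (6 + m)
no-long-palindrome 0 i = proj₁ (localFacts i)
no-long-palindrome 1 i = proj₁ (proj₂ (localFacts i))
no-long-palindrome (suc (suc m)) i pal = no-long-palindrome m (suc i) (PalAt-inner i (6 + m) pal)

palindrome-step : ∀ i ℓ → PalAt i ℓ → μ (i + ℓ) ≤ suc (μ i)
palindrome-step i ℓ pal with ℓ <? 6
... | no ℓ≮6 = ⊥-elim (no-long-palindrome (ℓ ∸ 6) i (subst (PalAt i) (sym (m+[n∸m]≡n (≮⇒≥ ℓ≮6))) pal))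
... | yes ℓ<6 = subst (λ j → PalAt i j → μ (i + j) ≤ suc (μ i)) (toℕ-fromℕ< ℓ<6)
                      (proj₂ (proj₂ (localFacts i)) (fromℕ< ℓ<6)) pal

lower-bound : ∀ ps i n → All IsNonemptyPalindrome ps → concat ps ≡ factor i n →
  μ (i + n) ≤ μ i + length ps
lower-bound [] i (suc n) _ ()
lower-bound [] i zero _ _ = ≤-reflexive (trans (cong μ (+-identityʳ i)) (sym (+-identityʳ (μ i))))
lower-bound (p ∷ ps) i n ((_ , pal) ∷ pals) eq with factor-split p (concat ps) i n eq
... | m , refl , p≡ , ps≡ = begin
  μ (i + (length p + m))          ≡⟨ cong μ (sym (+-assoc i (length p) m)) ⟩
  μ (i + length p + m)            ≤⟨ lower-bound ps (i + length p) m pals ps≡ ⟩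
  μ (i + length p) + length ps    ≤⟨ +-monoˡ-≤ (length ps) (palindrome-step i (length p) (palindrome⇒PalAt p i p≡ pal)) ⟩
  suc (μ i) + length ps           ≡⟨ sym (+-suc (μ i) (length ps)) ⟩
  μ i + length (p ∷ ps)           ∎
  where open ≤-Reasoning

palindrome? : ∀ w → Dec (IsPalindrome w)
palindrome? w = all? (λ k → lookup w k ≟ˡ lookup w (opposite k))

record LastPalindrome (n : ℕ) : Set where
  constructor lastPalindrome
  field
    start length′ : ℕ
    ends       : start + length′ ≡ n
    nonempty   : 1 ≤ length′
    short      : length′ ≤ 5
    palindrome : IsPalindrome (factor start length′)
    optimal    : suc (μ start) ≡ μ n

checkLast : ∀ i ℓ n → {{True (i + ℓ ≟ n)}} → {{True (1 ≤? ℓ)}} → {{True (ℓ ≤? 5)}} →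
  {{True (palindrome? (factor i ℓ))}} → {{True (suc (μ i) ≟ μ n)}} → LastPalindrome n
checkLast i ℓ n {{e}} {{l1}} {{l5}} {{p}} {{o}} =
  lastPalindrome i ℓ (toWitness e) (toWitness l1) (toWitness l5) (toWitness p) (toWitness o)

-- Shifting by one period: a short last palindrome for n ≥ 11 starts at ≥ 5,
-- where ω is 6-periodic and μ grows by exactly 2.
shift-last : ∀ k → LastPalindrome (11 + k) → LastPalindrome (17 + k)
shift-last k (lastPalindrome i ℓ ends l1 l5 pal opt) with 6 ≤? i
... | no i≱6 = ⊥-elim (i≱6 (+-cancelʳ-≤ 5 6 i
        (≤-trans (m≤m+n 11 k) (≤-trans (≤-reflexive (sym ends)) (+-monoʳ-≤ i l5)))))
... | yes (s≤s (s≤s (s≤s (s≤s (s≤s (s≤s {n = x} _)))))) =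
  lastPalindrome (12 + x) ℓ (cong (6 +_) ends) l1 l5
    (subst IsPalindrome (sym (factor-periodic (suc x) ℓ)) pal) (cong (λ j → suc (suc j)) opt)

last-palindrome : ∀ n → LastPalindrome (suc n)
last-palindrome 0 = checkLast 0 1 1
last-palindrome 1 = checkLast 0 2 2
last-palindrome 2 = checkLast 2 1 3
last-palindrome 3 = checkLast 1 3 4
last-palindrome 4 = checkLast 2 3 5
last-palindrome 5 = checkLast 5 1 6
last-palindrome 6 = checkLast 5 2 7
last-palindrome 7 = checkLast 3 5 8
last-palindrome 8 = checkLast 8 1 9
last-palindrome 9 = checkLast 6 4 10
last-palindrome 10 = checkLast 8 3 11
last-palindrome 11 = checkLast 11 1 12
last-palindrome 12 = checkLast 11 2 13
last-palindrome 13 = checkLast 10 4 14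
last-palindrome 14 = checkLast 14 1 15
last-palindrome 15 = checkLast 12 4 16
last-palindrome (suc (suc (suc (suc (suc (suc (suc (suc (suc (suc (suc (suc (suc (suc (suc (suc k)))))))))))))))) =
  shift-last k (last-palindrome (suc (suc (suc (suc (suc (suc (suc (suc (suc (suc k)))))))))))

Optimal : ℕ → Set
Optimal n = Σ (List Word) λ ps → PalFactorization (factor 0 n) ps × length ps ≡ μ n

append-palindrome : ∀ i ℓ → Optimal i → IsNonemptyPalindrome (factor i ℓ) →
  suc (μ i) ≡ μ (i + ℓ) → Optimal (i + ℓ)
append-palindrome i ℓ (ps , (pals , concat≡) , len) pal opt =
  ps ++ (w ∷ []) , (++⁺ pals (pal ∷ []) , concat≡′) , len′
  where
  w = factor i ℓ
  concat≡′ : concat (ps ++ (w ∷ [])) ≡ factor 0 (i + ℓ)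
  concat≡′ = begin
    concat (ps ++ (w ∷ []))  ≡⟨ sym (concat-++ ps (w ∷ [])) ⟩
    concat ps ++ (w ++ [])   ≡⟨ cong₂ _++_ concat≡ (++-identityʳ w) ⟩
    factor 0 i ++ w          ≡⟨ sym (factor-++ 0 i ℓ) ⟩
    factor 0 (i + ℓ)         ∎
    where open ≡-Reasoning
  len′ : length (ps ++ (w ∷ [])) ≡ μ (i + ℓ)
  len′ = trans (length-++ ps) (trans (+-comm (length ps) 1) (trans (cong suc len) opt))

upper-bound : ∀ n → Optimal n
upper-bound = <-rec Optimal extend
  where
  extend : ∀ n → (∀ {i} → i < n → Optimal i) → Optimal n
  extend zero _ = [] , ([] , refl) , refl
  extend (suc n) rec with last-palindrome n
  ... | lastPalindrome i ℓ ends 1≤ℓ _ pal opt =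
    subst Optimal ends (append-palindrome i ℓ (rec i<) (factor-nonempty i 1≤ℓ , pal) (trans opt (cong μ (sym ends))))
    where
    i< : i < suc n
    i< = subst (i <_) ends (m<m+n i 1≤ℓ)

aabab : Word
aabab = a ∷ a ∷ b ∷ a ∷ b ∷ []

bbaaba : Word
bbaaba = b ∷ b ∷ a ∷ a ∷ b ∷ a ∷ []

factor-power : ∀ t → factor 5 (t * 6) ≡ bbaaba ^ʷ t
factor-power zero = refl
factor-power (suc t) = cong (bbaaba ++_) (trans (factor-periodic 0 (t * 6)) (factor-power t))

wWord-prefix : ∀ t → wWord t ≡ factor 0 (5 + t * 6)
wWord-prefix t = trans (cong (aabab ++_) (sym (factor-power t))) (sym (factor-++ 0 5 (t * 6)))

⌊/3⌋-period : ∀ t x → ⌊ t * 6 + x /3⌋ ≡ t * 2 + ⌊ x /3⌋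
⌊/3⌋-period zero x = refl
⌊/3⌋-period (suc t) x = cong (λ j → suc (suc j)) (⌊/3⌋-period t x)

μ-period : ∀ t n → μ (t * 6 + suc n) ≡ t * 2 + μ (suc n)
μ-period t n = begin
  μ (t * 6 + suc n)               ≡⟨ cong μ (+-suc (t * 6) n) ⟩
  suc ⌊ suc (t * 6 + n) /3⌋       ≡⟨ cong (λ j → suc ⌊ j /3⌋) (sym (+-suc (t * 6) n)) ⟩
  suc ⌊ t * 6 + suc n /3⌋         ≡⟨ cong suc (⌊/3⌋-period t (suc n)) ⟩
  suc (t * 2 + ⌊ suc n /3⌋)       ≡⟨ sym (+-suc (t * 2) _) ⟩
  t * 2 + μ (suc n)               ∎
  where open ≡-Reasoning

μ-table : ∀ r → μ (5 + toℕ r) ≡ mTable r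
μ-table Fin.zero = refl
μ-table (Fin.suc Fin.zero) = refl
μ-table (Fin.suc (Fin.suc Fin.zero)) = refl
μ-table (Fin.suc (Fin.suc (Fin.suc Fin.zero))) = refl
μ-table (Fin.suc (Fin.suc (Fin.suc (Fin.suc Fin.zero)))) = refl
μ-table (Fin.suc (Fin.suc (Fin.suc (Fin.suc (Fin.suc Fin.zero))))) = refl

length-reorder : ∀ t c → 6 * t + 5 + c ≡ t * 6 + (5 + c)
length-reorder t c = trans (+-assoc (6 * t) 5 c) (cong (_+ (5 + c)) (*-comm 6 t))

μ-value : ∀ t r → μ (6 * t + 5 + toℕ r) ≡ 2 * t + mTable r
μ-value t r = begin
  μ (6 * t + 5 + toℕ r)     ≡⟨ cong μ (length-reorder t (toℕ r)) ⟩
  μ (t * 6 + (5 + toℕ r))   ≡⟨ μ-period t (4 + toℕ r) ⟩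
  t * 2 + μ (5 + toℕ r)     ≡⟨ cong₂ _+_ (*-comm t 2) (μ-table r) ⟩
  2 * t + mTable r          ∎
  where open ≡-Reasoning

u-prefix : ∀ t (r : Fin 6) → take (6 * t + 5 + toℕ r) (wWord (suc t)) ≡ factor 0 (6 * t + 5 + toℕ r)
u-prefix t r = trans (cong (take n) (wWord-prefix (suc t))) (take-factor 0 n _ n≤)
  where
  n = 6 * t + 5 + toℕ r
  n≤ : n ≤ 5 + suc t * 6
  n≤ = begin
    n                     ≡⟨ length-reorder t (toℕ r) ⟩
    t * 6 + (5 + toℕ r)   ≤⟨ +-monoʳ-≤ (t * 6) (+-monoʳ-≤ 5 (<⇒≤ (toℕ<n r))) ⟩
    t * 6 + 11            ≡⟨ +-comm (t * 6) 11 ⟩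
    5 + suc t * 6         ∎
    where open ≤-Reasoning

-- The theorem: m(u_n) = μ n, by the upper and lower bounds (the argument
-- does not need the hypothesis 1 ≤ t).
lemma8 : (t : ℕ) → 1 ≤ t → (r : Fin 6) →
    PalLength (take (6 * t + 5 + toℕ r) (wWord (suc t))) (2 * t + mTable r)
lemma8 t _ r rewrite u-prefix t r | sym (μ-value t r) =
  upper-bound n , λ ps (pals , concat≡) → lower-bound ps 0 n pals concat≡
  where n = 6 * t + 5 + toℕ r
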